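{- Let $f:\{0,1\}^n\to\{0,1\}$ be a monotone Boolean function and $g:\{0,1\}^m\to\{0,1\}$ a Boolean function. Then $\mathrm{KW}_f^+\otimes\mathrm{KW}_g^u\le\mathrm{KW}^u_{f\diamond g}$.
   Context: Values $\{0,u,1\}$, $0,1$ stable. For Boolean $h$ on $N$ variables and $x\in\{0,u,1\}^N$, $\tilde h(x)=b$ if $h(y)=b$ for all $y\in\{0,1\}^N$ agreeing with $x$ on stable coordinates, else $u$. Prime implicants $P_1^{(h)}$: $p$ with $\tilde h(p)=1$ such that replacing any stable coordinate by $u$ gives $\tilde h=u$; prime implicates $P_0^{(h)}$ analogously with $0$. Block composition: for $X\in\{0,1\}^{n\times m}$ with rows $X_i$, $(f\diamond g)(X)=f(g(X_1),\dots,g(X_n))$, with coordinates indexed by $[n]\times[m]$. Games (played on prime implicants/implicates): $\mathrm{KW}^u_h\subseteq P_1^{(h)}\times P_0^{(h)}\times[N]$ consists of $(p_1,p_0,i)$ with $(p_1)_i,(p_0)_i$ stable and different; for monotone $f$, $\mathrm{KW}^+_f\subseteq P_1^{(f)}\times P_0^{(f)}\times[n]$ consists of $(p_1,p_0,i)$ with $(p_1)_i=1$, $(p_0)_i=0$. Direct sum: for $\mathcal R\subseteq X\times Y\times Z$, $\mathcal R'\subseteq X'\times Y'\times Z'$, $\mathcal R\otimes\mathcal R'\subseteq(X\times X')\times(Y\times Y')\times(Z\times Z')$ contains $((x_1,x_2),(y_1,y_2),(z_1,z_2))$ iff $(x_1,y_1,z_1)\in\mathcal R$ and $(x_2,y_2,z_2)\in\mathcal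 R'$. Reduction: $\mathcal R\le\mathcal R'$ (with $\mathcal R'\subseteq X'\times Y'\times Z'$) if there are maps $\phi_1:X\to X'$, $\phi_2:Y\to Y'$, $\psi:Z'\to Z$ with $(\phi_1(x),\phi_2(y),z')\in\mathcal R'\Rightarrow(x,y,\psi(z'))\in\mathcal R$ for all $x,y,z'$. -}

module Defs where

open import Data.Bool using (Bool; true; false; not; _≤_)
open import Data.Nat using (ℕ)
open import Data.Fin using (Fin)
import Data.Fin.Properties as FinP
import Data.Product.Properties as ProdP
open import Relation.Nullary using (Dec)
open import Data.Product using (Σ; _×_; _,_; proj₁)
open import Relation.Binary.PropositionalEquality using (_≡_; _≢_)
open import Relation.Nullary using (¬_)
open import Relation.Nullary.Decidable using (does)

data T : Set where
  t0 u t1 : T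

st : Bool → T
st false = t0
st true  = t1

Stable : T → Set
Stable v = Σ Bool λ b → v ≡ st b

BoolFun : Set → Set
BoolFun I = (I → Bool) → Bool

Agrees : {I : Set} → (I → Bool) → (I → T) → Set
Agrees {I} y x = ∀ (i : I) (b : Bool) → x i ≡ st b → y i ≡ b

-- The hazard-free extension h̃, as a relation: HExt h x v  means  h̃(x) = v
HExt : {I : Set} → BoolFun I → (I → T) → T → Set
HExt h x t0 = ∀ y → Agrees y x → h y ≡ false
HExt h x t1 = ∀ y → Agrees y x → h y ≡ true
HExt h x u  = ¬ (∀ y → Agrees y x → h y ≡ false) × ¬ (∀ y → Agrees y x → h y ≡ true)

module _ {I : Set} (_≟_ : (i j : I) → Dec (i ≡ j)) where
  setU : (I → T) → I → (I → T)
  setU x i j with does (j ≟ i)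
  ... | true  = u
  ... | false = x j

  -- p is a prime implicant (b = true) / prime implicate (b = false) of h
  IsPrime : BoolFun I → Bool → (I → T) → Set
  IsPrime h b p = HExt h p (st b) × (∀ i → Stable (p i) → HExt h (setU p i) u)

  Prime : BoolFun I → Bool → Set
  Prime h b = Σ (I → T) (IsPrime h b)

  P₁ P₀ : BoolFun I → Set
  P₁ h = Prime h true
  P₀ h = Prime h false

  KWu : (h : BoolFun I) → P₁ h → P₀ h → I → Set
  KWu h p₁ p₀ i = Stable (proj₁ p₁ i) × Stable (proj₁ p₀ i) × proj₁ p₁ i ≢ proj₁ p₀ i

  KW⁺ : (f : BoolFun I) → P₁ f → P₀ f → I → Set
  KW⁺ f p₁ p₀ i = proj₁ p₁ i ≡ t1 × proj₁ p₀ i ≡ t0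

Monotone : {I : Set} → BoolFun I → Set
Monotone {I} f = ∀ (x y : I → Bool) → (∀ i → x i ≤ y i) → f x ≤ f y

_◇_ : {n m : ℕ} → BoolFun (Fin n) → BoolFun (Fin m) → BoolFun (Fin n × Fin m)
(f ◇ g) X = f (λ i → g (λ j → X (i , j)))

_≟ₙ_ : {n : ℕ} (i j : Fin n) → Dec (i ≡ j)
_≟ₙ_ = FinP._≟_

_≟ₙₘ_ : {n m : ℕ} (i j : Fin n × Fin m) → Dec (i ≡ j)
_≟ₙₘ_ = ProdP.≡-dec FinP._≟_ FinP._≟_

Rel3 : Set → Set → Set → Set₁
Rel3 X Y Z = X → Y → Z → Set

_⊗_ : {X Y Z X' Y' Z' : Set} → Rel3 X Y Z → Rel3 X' Y' Z' → Rel3 (X × X') (Y × Y') (Z × Z')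
(R ⊗ R') (x₁ , x₂) (y₁ , y₂) (z₁ , z₂) = R x₁ y₁ z₁ × R' x₂ y₂ z₂

_≼_ : {X Y Z X' Y' Z' : Set} → Rel3 X Y Z → Rel3 X' Y' Z' → Set
_≼_ {X} {Y} {Z} {X'} {Y'} {Z'} R R' =
  Σ (X → X') λ φ₁ → Σ (Y → Y') λ φ₂ → Σ (Z' → Z) λ ψ →
    ∀ x y z' → R' (φ₁ x) (φ₂ y) z' → R x y (ψ z')

{-# OPTIONS --safe #-}
-- The prime implicants (implicates) of a monotone f have no stable entry other than 1
-- (resp. 0). For prime b-implicants p of f and q of g, let p ◆ q be the ternary matrix whose
-- row k is q where p k is stable and all-u elsewhere. Under a stable p k each row is forced
-- to value b by g, so f ◇ g is forced to b. Releasing a stable entry (i , j) lets row i take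
-- both values of g: with a row of value ¬ b available, stacking it against completions of q
-- reproduces on the released matrix every point of the cube of p with p i released, where f
-- is not constantly b; a row of value b stacked against completions of q gives f ◇ g the
-- value b, as the all-b point lies in the cube of p. So p ◆ q is again prime, and a
-- coordinate (i , j) on which p₁ ◆ q₁ and p₀ ◆ q₀ differ stably has p₁ i = 1, p₀ i = 0 and
-- q₁ j, q₀ j stable and distinct.
module Submission where

open import Defs
open import Data.Nat using (ℕ)
open import Data.Fin using (Fin)
open import Data.Bool using (Bool; true; false; not; if_then_else_; f≤t; b≤b)
  renaming (_≤_ to _≤ᵇ_; _≟_ to _≟ᵇ_)
open import Data.Bool.Properties using (not-¬; ¬-not)
open import Data.Product using (_×_; _,_; proj₁; proj₂; curry; uncurry)
open import Function using (id)
open import Relation.Binary.Definitions using (DecidableEquality)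
open import Relation.Binary.PropositionalEquality using (_≡_; _≢_; refl; sym; trans; cong)
open import Relation.Nullary using (¬_; yes; no; does; contradiction)

st-injective : ∀ {a b} → st a ≡ st b → a ≡ b
st-injective {false} {false} _ = refl
st-injective {true}  {true}  _ = refl
st-injective {false} {true}  ()
st-injective {true}  {false} ()

u≢st : ∀ {b} → u ≢ st b
u≢st {false} ()
u≢st {true}  ()

ConstOn : {I : Set} → BoolFun I → (I → T) → Bool → Set
ConstOn h x b = ∀ y → Agrees y x → h y ≡ b

module _ {I : Set} {h : BoolFun I} {x : I → T} where

  HExt-st⇒ : ∀ {b} → HExt h x (st b) → ConstOn h x b
  HExt-st⇒ {false} = id
  HExt-st⇒ {true}  = id

  HExt-st⇐ : ∀ {b} → ConstOn h x b → HExt h x (st b)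
  HExt-st⇐ {false} = id
  HExt-st⇐ {true}  = id

  HExt-u⇒ : HExt h x u → ∀ b → ¬ ConstOn h x b
  HExt-u⇒ (¬const₀ , _) false = ¬const₀
  HExt-u⇒ (_ , ¬const₁) true  = ¬const₁

  HExt-u⇐ : ∀ b → ¬ ConstOn h x b → ¬ ConstOn h x (not b) → HExt h x u
  HExt-u⇐ false ¬const ¬const-not = ¬const , ¬const-not
  HExt-u⇐ true  ¬const ¬const-not = ¬const-not , ¬const

resolve : T → Bool
resolve t0 = false
resolve t1 = true
resolve u  = false

completion : {I : Set} → (I → T) → I → Bool
completion x i = resolve (x i)

resolve-st : ∀ b → resolve (st b) ≡ b
resolve-st false = refl
resolve-st true  = refl

completion-agrees : {I : Set} (x : I → T) → Agrees (completion x) x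
completion-agrees x i b xi = trans (cong resolve xi) (resolve-st b)

≤ᵇ⇒true-preserving : ∀ {a c} → a ≤ᵇ c → a ≡ true → c ≡ true
≤ᵇ⇒true-preserving f≤t _ = refl
≤ᵇ⇒true-preserving b≤b = id

true-preserving⇒≤ᵇ : ∀ {a c} → (a ≡ true → c ≡ true) → a ≤ᵇ c
true-preserving⇒≤ᵇ {false} {false} _ = b≤b
true-preserving⇒≤ᵇ {false} {true}  _ = f≤t
true-preserving⇒≤ᵇ {true}  {true}  _ = b≤b
true-preserving⇒≤ᵇ {true}  {false} a→c with () ← a→c refl

≤ᵇ⇒false-reflecting : ∀ {a c} → a ≤ᵇ c → c ≡ false → a ≡ false
≤ᵇ⇒false-reflecting b≤b = id

false-reflecting⇒≤ᵇ : ∀ {a c} → (c ≡ false → a ≡ false) → a ≤ᵇ c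
false-reflecting⇒≤ᵇ {false} {false} _ = b≤b
false-reflecting⇒≤ᵇ {false} {true}  _ = f≤t
false-reflecting⇒≤ᵇ {true}  {true}  _ = b≤b
false-reflecting⇒≤ᵇ {true}  {false} c→a with () ← c→a refl

monotone-preserves : {I : Set} {f : BoolFun I} → Monotone f →
                     ∀ b {w w′} → (∀ k → w k ≡ b → w′ k ≡ b) → f w ≡ b → f w′ ≡ b
monotone-preserves mono true  {w} {w′} w→w′ =
  ≤ᵇ⇒true-preserving (mono w w′ (λ k → true-preserving⇒≤ᵇ (w→w′ k)))
monotone-preserves mono false {w} {w′} w→w′ =
  ≤ᵇ⇒false-reflecting (mono w′ w (λ k → false-reflecting⇒≤ᵇ (w→w′ k)))

module _ {I : Set} (_≟_ : DecidableEquality I) where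

  setU-≢ : ∀ (x : I → T) {i j} → j ≢ i → setU _≟_ x i j ≡ x j
  setU-≢ x {i} {j} j≢i with j ≟ i
  ... | yes j≡i = contradiction j≡i j≢i
  ... | no _    = refl

  setU-stable : ∀ (x : I → T) {i j b} → setU _≟_ x i j ≡ st b → j ≢ i × x j ≡ st b
  setU-stable x {i} {j} xj with j ≟ i
  ... | yes _   = contradiction xj u≢st
  ... | no j≢i  = j≢i , xj

  agrees-setU : ∀ {y} {x : I → T} {i} → Agrees y x → Agrees y (setU _≟_ x i)
  agrees-setU {x = x} y~x j b xj = y~x j b (proj₂ (setU-stable x xj))

  update : (I → Bool) → I → Bool → I → Bool
  update y i v j = if does (j ≟ i) then v else y j

  module _ {f : BoolFun I} (mono : Monotone f) {b : Bool} {p : I → T}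
           (p-prime : IsPrime _≟_ f b p) where

    prime-no-opposite : ∀ k → p k ≢ st (not b)
    prime-no-opposite k pk≡¬b = HExt-u⇒ (proj₂ p-prime k (not b , pk≡¬b)) b const
      where
      -- Resetting coordinate k of y to ¬ b moves it into the cube of p and away from b.
      const : ConstOn f (setU _≟_ p k) b
      const y y~ = monotone-preserves mono b y′→y (HExt-st⇒ (proj₁ p-prime) y′ y′~p)
        where
        y′ : I → Bool
        y′ = update y k (not b)

        y′~p : Agrees y′ p
        y′~p l b′ pl with l ≟ k
        ... | yes refl = st-injective (trans (sym pk≡¬b) pl)
        ... | no l≢k   = y~ l b′ (trans (setU-≢ p l≢k) pl)

        y′→y : ∀ l → y′ l ≡ b → y l ≡ b
        y′→y l with l ≟ k
        ... | yes _ = λ ¬b≡b → contradiction (sym ¬b≡b) (not-¬ refl)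
        ... | no _  = id

    prime-value : ∀ {k b′} → p k ≡ st b′ → b′ ≡ b
    prime-value {k} {b′} pk with b′ ≟ᵇ b
    ... | yes b′≡b = b′≡b
    ... | no b′≢b  = contradiction (trans pk (cong st (¬-not b′≢b))) (prime-no-opposite k)

    prime-stable : ∀ {k} → Stable (p k) → p k ≡ st b
    prime-stable (b′ , pk) with refl ← prime-value pk = pk

    prime-agrees-const : Agrees (λ _ → b) p
    prime-agrees-const _ _ pk = sym (prime-value pk)

mask : T → T → T
mask t0 v = v
mask t1 v = v
mask u  _ = u

mask-of-stable : ∀ {s} v → Stable s → mask s v ≡ v
mask-of-stable v (false , refl) = refl
mask-of-stable v (true  , refl) = refl

mask-stable : ∀ {s v b} → mask s v ≡ st b → Stable s × v ≡ st b
mask-stable {t0} vb = (false , refl) , vb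
mask-stable {t1} vb = (true , refl) , vb
mask-stable {u}  ub = contradiction ub u≢st

_◆_ : {n m : ℕ} → (Fin n → T) → (Fin m → T) → Fin n × Fin m → T
(p ◆ q) (k , j) = mask (p k) (q j)

◆-stable : ∀ {n m} (p : Fin n → T) (q : Fin m → T) {i j} →
           Stable ((p ◆ q) (i , j)) → Stable (p i) × Stable (q j)
◆-stable p q (b , e) with mask-stable e
... | pᵢ , qⱼ = pᵢ , (b , qⱼ)

module _ {n m : ℕ} {p : Fin n → T} {q : Fin m → T} where

  row-agrees : ∀ {Y k} → Agrees Y (p ◆ q) → Stable (p k) → Agrees (curry Y k) q
  row-agrees {k = k} Y~ pk j b qⱼ = Y~ (k , j) b (trans (mask-of-stable (q j) pk) qⱼ)

  stacked-agrees : ∀ {i j} (R : Fin n → Fin m → Bool) →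
                   Agrees (R i) (setU _≟ₙ_ q j) →
                   (∀ k → k ≢ i → Stable (p k) → Agrees (R k) q) →
                   Agrees (uncurry R) (setU _≟ₙₘ_ (p ◆ q) (i , j))
  stacked-agrees {i} {j} R Rᵢ~ Rₖ~ (k , l) b e with setU-stable _≟ₙₘ_ (p ◆ q) e
  ... | kl≢ij , e′ with mask-stable {p k} e′
  ...   | pk , ql with k ≟ₙ i
  ...     | yes refl = Rᵢ~ l b (trans (setU-≢ _≟ₙ_ q (λ l≡j → kl≢ij (cong (i ,_) l≡j))) ql)
  ...     | no k≢i   = Rₖ~ k k≢i pk l b ql

module _ {n m : ℕ} {f : BoolFun (Fin n)} {g : BoolFun (Fin m)} (mono : Monotone f) {b : Bool}
         {p : Fin n → T} {q : Fin m → T}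
         (p-prime : IsPrime _≟ₙ_ f b p) (q-prime : IsPrime _≟ₙ_ g b q) where

  private
    c : Fin m → Bool
    c = completion q

    g-c : g c ≡ b
    g-c = HExt-st⇒ (proj₁ q-prime) c (completion-agrees q)

    f-const : f (λ _ → b) ≡ b
    f-const = HExt-st⇒ (proj₁ p-prime) _ (prime-agrees-const _≟ₙ_ mono p-prime)

  ◆-implicant : ConstOn (f ◇ g) (p ◆ q) b
  ◆-implicant Y Y~ = HExt-st⇒ (proj₁ p-prime) _ λ k b′ pk →
    trans (HExt-st⇒ (proj₁ q-prime) (curry Y k) (row-agrees Y~ (b′ , pk)))
          (sym (prime-value _≟ₙ_ mono p-prime pk))

  module _ {i : Fin n} {j : Fin m} (pᵢ : Stable (p i)) (qⱼ : Stable (q j)) where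

    private
      X′ : Fin n × Fin m → T
      X′ = setU _≟ₙₘ_ (p ◆ q) (i , j)

      rows : (Fin n → Bool) → (Fin m → Bool) → Fin n → Fin m → Bool
      rows S y k = if S k then y else c

      rows-agree : ∀ S {y} → Agrees y (setU _≟ₙ_ q j) →
                   (∀ k → S k ≡ true → Stable (p k) → k ≡ i) →
                   Agrees (uncurry (rows S y)) X′
      rows-agree S {y} y~ exceptional = stacked-agrees (rows S y) rowᵢ rowₖ
        where
        rowᵢ : Agrees (rows S y i) (setU _≟ₙ_ q j)
        rowᵢ with S i
        ... | true  = y~
        ... | false = agrees-setU _≟ₙ_ (completion-agrees q)

        rowₖ : ∀ k → k ≢ i → Stable (p k) → Agrees (rows S y k) q
        rowₖ k k≢i pk with S k in Sk
        ... | true  = contradiction (exceptional k Sk pk) k≢i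
        ... | false = completion-agrees q

      g-rows : ∀ S {y} → g y ≡ b → ∀ k → g (rows S y k) ≡ b
      g-rows S gy k with S k
      ... | true  = gy
      ... | false = g-c

    ¬const-b : ¬ ConstOn (f ◇ g) X′ b
    ¬const-b const = HExt-u⇒ (proj₂ q-prime j qⱼ) b q-released-const
      where
      q-released-const : ConstOn g (setU _≟ₙ_ q j) b
      q-released-const y y~ with g y ≟ᵇ b
      ... | yes gy≡b = gy≡b
      ... | no gy≢b  = contradiction p-released-const (HExt-u⇒ (proj₂ p-prime i pᵢ) b)
        where
        p-released-const : ConstOn f (setU _≟ₙ_ p i) b
        p-released-const z z~ =
          monotone-preserves mono b realised (const _ (rows-agree S y~ exceptional))
          where
          S : Fin n → Bool
          S k = not (does (z k ≟ᵇ b))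

          exceptional : ∀ k → S k ≡ true → Stable (p k) → k ≡ i
          exceptional k Sk pk with k ≟ₙ i | z k ≟ᵇ b
          ... | yes k≡i | _       = k≡i
          ... | no k≢i  | no zk≢b =
            contradiction (z~ k b (trans (setU-≢ _≟ₙ_ p k≢i) (prime-stable _≟ₙ_ mono p-prime pk))) zk≢b

          -- The stacked rows take the values of z under g; lacking function extensionality,
          -- monotonicity carries f across this pointwise agreement.
          realised : ∀ k → g (rows S y k) ≡ b → z k ≡ b
          realised k with z k ≟ᵇ b
          ... | yes zk≡b = λ _ → zk≡b
          ... | no _     = λ gy≡b → contradiction gy≡b gy≢b

    ¬const-¬b : ¬ ConstOn (f ◇ g) X′ (not b)
    ¬const-¬b const = HExt-u⇒ (proj₂ q-prime j qⱼ) (not b) q-released-const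
      where
      S : Fin n → Bool
      S k = does (k ≟ₙ i)

      exceptional : ∀ k → S k ≡ true → Stable (p k) → k ≡ i
      exceptional k Sk _ with k ≟ₙ i
      ... | yes k≡i = k≡i

      q-released-const : ConstOn g (setU _≟ₙ_ q j) (not b)
      q-released-const y y~ with g y ≟ᵇ b
      ... | no gy≢b  = ¬-not gy≢b
      ... | yes gy≡b = contradiction (const _ (rows-agree S y~ exceptional)) (not-¬ f-rows)
        where
        f-rows : f (λ k → g (rows S y k)) ≡ b
        f-rows = monotone-preserves mono b (λ k _ → g-rows S gy≡b k) f-const

    ◆-setU-undetermined : HExt (f ◇ g) X′ u
    ◆-setU-undetermined = HExt-u⇐ b ¬const-b ¬const-¬b

  ◆-prime : IsPrime _≟ₙₘ_ (f ◇ g) b (p ◆ q)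
  ◆-prime = HExt-st⇐ ◆-implicant , λ (i , j) s →
    let (pᵢ , qⱼ) = ◆-stable p q s in ◆-setU-undetermined pᵢ qⱼ

lemma5p3 : (n m : ℕ) (f : BoolFun (Fin n)) (g : BoolFun (Fin m)) → Monotone f →
    (KW⁺ _≟ₙ_ f ⊗ KWu _≟ₙ_ g) ≼ KWu _≟ₙₘ_ (f ◇ g)
lemma5p3 n m f g mono = compose true , compose false , id , solves
  where
  compose : ∀ b → Prime _≟ₙ_ f b × Prime _≟ₙ_ g b → Prime _≟ₙₘ_ (f ◇ g) b
  compose b ((p , p-prime) , (q , q-prime)) = p ◆ q , ◆-prime mono p-prime q-prime

  solves : ∀ x y z → KWu _≟ₙₘ_ (f ◇ g) (compose true x) (compose false y) z →
           (KW⁺ _≟ₙ_ f ⊗ KWu _≟ₙ_ g) x y z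
  solves ((p₁ , p₁-prime) , (q₁ , _)) ((p₀ , p₀-prime) , (q₀ , _)) (i , j) (s₁ , s₀ , differ)
    with ◆-stable p₁ q₁ s₁ | ◆-stable p₀ q₀ s₀
  ... | p₁i , q₁j | p₀i , q₀j =
        (prime-stable _≟ₙ_ mono p₁-prime p₁i , prime-stable _≟ₙ_ mono p₀-prime p₀i)
      , q₁j , q₀j
      , λ q₁j≡q₀j → differ (trans (mask-of-stable (q₁ j) p₁i)
                                  (trans q₁j≡q₀j (sym (mask-of-stable (q₀ j) p₀i))))
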